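{- The Coxeter graph admits a perfect $1$-code.
   Context: The Coxeter graph is the unique distance-regular graph with intersection array $\{3,2,2,1;1,1,1,2\}$; it is cubic with $28$ vertices and diameter $4$. A perfect $1$-code is a vertex subset $C$ such that the closed neighbourhoods of the vertices of $C$ partition the vertex set. -}

module Defs where

open import Level using (Level; 0ℓ)
open import Data.Nat using (ℕ; _+_)
open import Data.Nat.DivMod using (_mod_)
open import Data.Fin using (Fin; toℕ)
open import Data.Product using (Σ; _×_; _,_)
open import Data.Sum using (_⊎_)
open import Relation.Binary.PropositionalEquality using (_≡_)
open import Relation.Unary using (Pred; _∈_)

ClosedNbhd : {V : Set} → (V → V → Set) → V → Pred V 0ℓ
ClosedNbhd Adj c v = (v ≡ c) ⊎ Adj c v

IsPerfectOneCode : {V : Set} → (V → V → Set) → Pred V 0ℓ → Set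
IsPerfectOneCode {V} Adj C =
  (v : V) → Σ V λ c → (c ∈ C × v ∈ ClosedNbhd Adj c)
                    × ((c' : V) → c' ∈ C → v ∈ ClosedNbhd Adj c' → c' ≡ c)

-- The Coxeter graph (standard construction, 28 vertices):
-- vertices a_i, b_i, c_i, d_i (i ∈ ℤ/7); d_i ~ a_i, b_i, c_i;
-- a_i ~ a_{i+1}, b_i ~ b_{i+2}, c_i ~ c_{i+3}.

data Label : Set where
  a b c d : Label

data Rim : Set where
  ra rb rc : Rim

rimLabel : Rim → Label
rimLabel ra = a
rimLabel rb = b
rimLabel rc = c

step : Rim → ℕ
step ra = 1
step rb = 2
step rc = 3

_+₇_ : Fin 7 → ℕ → Fin 7
i +₇ k = (toℕ i + k) mod 7

CoxeterVertex : Set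
CoxeterVertex = Label × Fin 7

data CoxeterAdj : CoxeterVertex → CoxeterVertex → Set where
  hub   : (r : Rim) (i : Fin 7) → CoxeterAdj (d , i) (rimLabel r , i)
  hub'  : (r : Rim) (i : Fin 7) → CoxeterAdj (rimLabel r , i) (d , i)
  cyc   : (r : Rim) (i : Fin 7) → CoxeterAdj (rimLabel r , i) (rimLabel r , i +₇ step r)
  cyc'  : (r : Rim) (i : Fin 7) → CoxeterAdj (rimLabel r , i +₇ step r) (rimLabel r , i)

{-# OPTIONS --safe #-}
-- The code is d₅ together with the two vertices (r , 5 ± 2·step r) on each
-- rim r.  On the 7-cycle of rim r (in steps of step r, starting at 5) the
-- positions 0, ±1, ±2, ±3 are covered by d₅ and the two rim codewords, and a
-- hub d_j with j ≠ 5 is covered by the rim codeword at position j, since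
-- {±2, ±4, ±6} exhausts the nonzero residues mod 7.  Sending each vertex to
-- the codeword covering it gives a retraction onto the code that is constant
-- on closed neighbourhoods of codewords, which is exactly perfectness.
module Submission where

open import Defs
open import Level using (0ℓ)
open import Data.Fin using (Fin)
open import Data.Fin.Patterns using (0F; 1F; 2F; 3F; 4F; 5F; 6F)
import Data.Fin.Properties as Fin
open import Data.List using (List; []; _∷_; cartesianProduct; allFin)
open import Data.List.Membership.Propositional using () renaming (_∈_ to _∈ˡ_)
open import Data.List.Membership.Propositional.Properties
  using (∈-cartesianProduct⁺; ∈-allFin)
import Data.List.Membership.DecPropositional as DecMembership
open import Data.List.Relation.Unary.All as All using (all?)
open import Data.List.Relation.Unary.Any using (here; there)
open import Data.Product using (Σ; _,_; proj₁; proj₂)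
open import Data.Product.Properties using (≡-dec)
open import Data.Sum using (inj₁; inj₂)
import Data.Vec as Vec
open import Function.Bundles using (mk↣)
open import Relation.Binary.Definitions using (DecidableEquality)
open import Relation.Binary.PropositionalEquality using (_≡_; refl; sym; trans; cong)
open import Relation.Nullary.Decidable using (Dec; True; map′; toWitness; via-injection; _→-dec_)
open import Relation.Unary using (Pred; Decidable; _∈_)

retraction⇒isPerfectOneCode :
  {V : Set} {Adj : V → V → Set} {C : Pred V 0ℓ} (ρ : V → V) →
  (∀ v → ρ v ∈ C) → (∀ v → v ∈ ClosedNbhd Adj (ρ v)) →
  (∀ {w} → w ∈ C → ρ w ≡ w) → (∀ {w v} → w ∈ C → Adj w v → ρ v ≡ w) →
  IsPerfectOneCode Adj C
retraction⇒isPerfectOneCode {V} {Adj} {C} ρ ρ∈C v∈N[ρv] ρ-fixes-C ρ-constant-on-N[w] v =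
  ρ v , (ρ∈C v , v∈N[ρv] v) , unique
  where
  unique : ∀ w → w ∈ C → v ∈ ClosedNbhd Adj w → w ≡ ρ v
  unique w w∈C (inj₁ refl) = sym (ρ-fixes-C w∈C)
  unique w w∈C (inj₂ w~v)  = sym (ρ-constant-on-N[w] w∈C w~v)

∀? : {A : Set} {P : Pred A 0ℓ} {xs : List A} →
     (∀ x → x ∈ˡ xs) → Decidable P → Dec (∀ x → P x)
∀? complete P? = map′ (λ all x → All.lookup all (complete x))
                      (λ ∀P → All.tabulate (λ {x} _ → ∀P x))
                      (all? P? _)

labels : List Label
labels = a ∷ b ∷ c ∷ d ∷ []

∈-labels : ∀ l → l ∈ˡ labels
∈-labels a = here refl
∈-labels b = there (here refl)
∈-labels c = there (there (here refl))
∈-labels d = there (there (there (here refl)))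

rims : List Rim
rims = ra ∷ rb ∷ rc ∷ []

∈-rims : ∀ r → r ∈ˡ rims
∈-rims ra = here refl
∈-rims rb = there (here refl)
∈-rims rc = there (there (here refl))

vertices : List CoxeterVertex
vertices = cartesianProduct labels (allFin 7)

∈-vertices : ∀ v → v ∈ˡ vertices
∈-vertices (l , i) = ∈-cartesianProduct⁺ (∈-labels l) (∈-allFin i)

labelIndex : Label → Fin 4
labelIndex a = 0F
labelIndex b = 1F
labelIndex c = 2F
labelIndex d = 3F

labelIndex-inverse : ∀ l → Vec.lookup (Vec.fromList labels) (labelIndex l) ≡ l
labelIndex-inverse a = refl
labelIndex-inverse b = refl
labelIndex-inverse c = refl
labelIndex-inverse d = refl

labelIndex-injective : ∀ {l l′} → labelIndex l ≡ labelIndex l′ → l ≡ l′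
labelIndex-injective {l} {l′} eq =
  trans (sym (labelIndex-inverse l))
        (trans (cong (Vec.lookup (Vec.fromList labels)) eq) (labelIndex-inverse l′))

_≟ᴸ_ : DecidableEquality Label
_≟ᴸ_ = via-injection (mk↣ labelIndex-injective) Fin._≟_

_≟_ : DecidableEquality CoxeterVertex
_≟_ = ≡-dec _≟ᴸ_ Fin._≟_

open DecMembership _≟_ using (_∈?_)

a₀ a₃ b₁ b₂ c₄ c₆ d₅ : CoxeterVertex
a₀ = a , 0F
a₃ = a , 3F
b₁ = b , 1F
b₂ = b , 2F
c₄ = c , 4F
c₆ = c , 6F
d₅ = d , 5F

codewords : List CoxeterVertex
codewords = d₅ ∷ a₀ ∷ a₃ ∷ b₁ ∷ b₂ ∷ c₄ ∷ c₆ ∷ []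

CoxeterCode : Pred CoxeterVertex 0ℓ
CoxeterCode v = v ∈ˡ codewords

cover : ∀ v → Σ CoxeterVertex λ w → v ∈ ClosedNbhd CoxeterAdj w
cover (a , 0F) = a₀ , inj₁ refl
cover (a , 1F) = a₀ , inj₂ (cyc ra 0F)
cover (a , 2F) = a₃ , inj₂ (cyc' ra 2F)
cover (a , 3F) = a₃ , inj₁ refl
cover (a , 4F) = a₃ , inj₂ (cyc ra 3F)
cover (a , 5F) = d₅ , inj₂ (hub ra 5F)
cover (a , 6F) = a₀ , inj₂ (cyc' ra 6F)
cover (b , 0F) = b₂ , inj₂ (cyc' rb 0F)
cover (b , 1F) = b₁ , inj₁ refl
cover (b , 2F) = b₂ , inj₁ refl
cover (b , 3F) = b₁ , inj₂ (cyc rb 1F)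
cover (b , 4F) = b₂ , inj₂ (cyc rb 2F)
cover (b , 5F) = d₅ , inj₂ (hub rb 5F)
cover (b , 6F) = b₁ , inj₂ (cyc' rb 6F)
cover (c , 0F) = c₄ , inj₂ (cyc rc 4F)
cover (c , 1F) = c₄ , inj₂ (cyc' rc 1F)
cover (c , 2F) = c₆ , inj₂ (cyc rc 6F)
cover (c , 3F) = c₆ , inj₂ (cyc' rc 3F)
cover (c , 4F) = c₄ , inj₁ refl
cover (c , 5F) = d₅ , inj₂ (hub rc 5F)
cover (c , 6F) = c₆ , inj₁ refl
cover (d , 0F) = a₀ , inj₂ (hub' ra 0F)
cover (d , 1F) = b₁ , inj₂ (hub' rb 1F)
cover (d , 2F) = b₂ , inj₂ (hub' rb 2F)
cover (d , 3F) = a₃ , inj₂ (hub' ra 3F)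
cover (d , 4F) = c₄ , inj₂ (hub' rc 4F)
cover (d , 5F) = d₅ , inj₁ refl
cover (d , 6F) = c₆ , inj₂ (hub' rc 6F)

owner : CoxeterVertex → CoxeterVertex
owner v = proj₁ (cover v)

OwnedBy : CoxeterVertex → CoxeterVertex → Set
OwnedBy v w = w ∈ CoxeterCode → owner v ≡ w

ownedBy? : ∀ v w → Dec (OwnedBy v w)
ownedBy? v w = (w ∈? codewords) →-dec (owner v ≟ w)

owner∈code : ∀ v → owner v ∈ CoxeterCode
owner∈code = toWitness {a? = ∀? ∈-vertices (λ v → owner v ∈? codewords)} _

owner-fixes-code : ∀ {w} → w ∈ CoxeterCode → owner w ≡ w
owner-fixes-code {w} = toWitness {a? = ∀? ∈-vertices (λ v → ownedBy? v v)} _ w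

-- The implicit ⊤-valued argument is filled in by evaluating the decision.
owner-of-edge-family :
  (x y : Rim → Fin 7 → CoxeterVertex) →
  {_ : True (∀? ∈-rims λ r → Fin.all? λ i → ownedBy? (y r i) (x r i))} →
  ∀ r i → OwnedBy (y r i) (x r i)
owner-of-edge-family x y {check} = toWitness check

owner-of-neighbour : ∀ {w v} → w ∈ CoxeterCode → CoxeterAdj w v → owner v ≡ w
owner-of-neighbour w∈C (hub r i) =
  owner-of-edge-family (λ _ i → d , i) (λ r i → rimLabel r , i) r i w∈C
owner-of-neighbour w∈C (hub' r i) =
  owner-of-edge-family (λ r i → rimLabel r , i) (λ _ i → d , i) r i w∈C
owner-of-neighbour w∈C (cyc r i) =
  owner-of-edge-family (λ r i → rimLabel r , i) (λ r i → rimLabel r , i +₇ step r) r i w∈C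
owner-of-neighbour w∈C (cyc' r i) =
  owner-of-edge-family (λ r i → rimLabel r , i +₇ step r) (λ r i → rimLabel r , i) r i w∈C

proposition5p6 : Σ (Pred CoxeterVertex 0ℓ) λ C → IsPerfectOneCode CoxeterAdj C
proposition5p6 =
  CoxeterCode ,
  retraction⇒isPerfectOneCode owner owner∈code (λ v → proj₂ (cover v))
                              owner-fixes-code owner-of-neighbour
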